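{- Let $G$ be a finite group, $H$ a proper subgroup of $G$, $m=|G:H|$, and let $\mathcal{S}_0$ be a partition of $H$ which is the set of basic sets of an S-ring $\mathcal{A}_0$ over $H$. Then $\mathcal{S}_0\cup\{G\setminus H\}$ is the set of basic sets of an S-ring $\mathcal{A}$ over $G$, and $\mathcal{A}$ is isomorphic to the wreath product $\mathcal{A}_0\wr\mathcal{T}_{C_m}$.
   Context: For a finite group $G$ with identity $e$ and $X\subseteq G$, put $\underline{X}=\sum_{x\in X}x\in\mathbb{Z}G$. An S-ring over $G$ is a subring $\mathcal{A}\subseteq\mathbb{Z}G$ for which there is a partition $\mathcal{S}(\mathcal{A})$ of $G$ (the basic sets) with $\{e\}\in\mathcal{S}(\mathcal{A})$, $X^{ -1}\in\mathcal{S}(\mathcal{A})$ for $X\in\mathcal{S}(\mathcal{A})$, and $\mathcal{A}=\mathrm{Span}_{\mathbb{Z}}\{\underline{X}:X\in\mathcal{S}(\mathcal{A})\}$. $C_m$ is the cyclic group of order $m$ and $\mathcal{T}_{C_m}$ is the S-ring over $C_m$ with basic sets $\{e\}$ and $C_m\setminus\{e\}$. If $L$ is a normal subgroup of a group $K$, $\mathcal{A}_1$ an S-ring over $L$ and $\mathcal{A}_2$ an S-ring over $K/L$, the wreath product $\mathcal{A}_1\wr\mathcal{A}_2$ is the S-ring over $K$ whose basic sets are the basic sets of $\mathcal{A}_1$ together with the full preimages $\pi^{ -1}(X)$ of the basic sets $X\neq\{L\}$ of $\mathcal{A}_2$, where $\pi:K\to K/L$ is the canonical epimorphism; here $\mathcal{A}_0\wr\mathcal{T}_{C_m}$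 is taken over $H\times C_m$ with $L=H\times\{e\}$. For $X\subseteq G$ let $E(X)=\{(g,xg):g\in G,x\in X\}$. S-rings $\mathcal{A}_1$ over $G_1$ and $\mathcal{A}_2$ over $G_2$ are isomorphic if there is a bijection $f:G_1\to G_2$ with $\{E(X_1)^f:X_1\in\mathcal{S}(\mathcal{A}_1)\}=\{E(X_2):X_2\in\mathcal{S}(\mathcal{A}_2)\}$, where $E(X_1)^f=\{(u^f,v^f):(u,v)\in E(X_1)\}$. -}

module Defs where

open import Level using (0ℓ)
open import Data.Bool using (Bool; true; false; if_then_else_; not; _∧_; _∨_)
open import Data.Nat as ℕ using (ℕ; zero; suc)
open import Data.Fin as Fin using (Fin)
open import Data.Fin.Properties using (*↔×)
open import Data.Integer as ℤ using (ℤ)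
open import Data.List using (List; length; lookup; map; filter; _++_; [_]; _∷_; [])
open import Data.Product using (Σ; ∃; ∃-syntax; _×_; _,_; proj₁; proj₂)
open import Data.Product.Function.NonDependent.Propositional using (_×-↔_)
open import Function using (_∘_; _↔_; Inverse)
open import Function.Properties.Inverse using (↔-trans; ↔-sym)
open import Function.Bundles using (_⇔_)
open import Algebra.Structures using (IsGroup; IsMonoid; IsSemigroup; IsMagma)
open import Relation.Binary.PropositionalEquality
  using (_≡_; refl; cong; cong₂; trans; sym; isEquivalence)
open import Relation.Nullary using (¬_; Dec; yes; no; does)

record FinGroup : Set₁ where
  infixl 7 _∙_
  field
    Carrier : Set
    _∙_     : Carrier → Carrier → Carrier
    ε       : Carrier
    _⁻¹     : Carrier → Carrier
    isGroup : IsGroup _≡_ _∙_ ε _⁻¹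
    order   : ℕ
    enum    : Carrier ↔ Fin order

  elem : Fin order → Carrier
  elem = Inverse.from enum

  _≟_ : (a b : Carrier) → Dec (a ≡ b)
  a ≟ b with Inverse.to enum a Fin.≟ Inverse.to enum b
  ... | yes p = yes (trans (sym (Inverse.strictlyInverseʳ enum a))
                     (trans (cong (Inverse.from enum) p) (Inverse.strictlyInverseʳ enum b)))
  ... | no ¬p = no (λ q → ¬p (cong (Inverse.to enum) q))

  _==_ : Carrier → Carrier → Bool
  a == b = does (a ≟ b)

  _^_ : Carrier → ℕ → Carrier
  x ^ zero  = ε
  x ^ suc k = x ∙ (x ^ k)

open FinGroup public using (Carrier; order)

sumFin : (n : ℕ) → (Fin n → ℤ) → ℤ
sumFin zero    f = ℤ.+ 0
sumFin (suc n) f = f Fin.zero ℤ.+ sumFin n (f ∘ Fin.suc)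

anyFin : (n : ℕ) → (Fin n → Bool) → Bool
anyFin zero    p = false
anyFin (suc n) p = p Fin.zero ∨ anyFin n (p ∘ Fin.suc)

allFin : (n : ℕ) → (Fin n → Bool) → Bool
allFin zero    p = true
allFin (suc n) p = p Fin.zero ∧ allFin n (p ∘ Fin.suc)

Subset : FinGroup → Set
Subset G = Carrier G → Bool

_∈ₛ_ : {A : Set} → A → (A → Bool) → Set
x ∈ₛ X = X x ≡ true

-- ℤG: finitely supported ℤ-valued functions on G (G finite)
ℤ[_] : FinGroup → Set
ℤ[ G ] = Carrier G → ℤ

mulZG : (G : FinGroup) → ℤ[ G ] → ℤ[ G ] → ℤ[ G ]
mulZG G a b g = sumFin (FinGroup.order G) (λ i → a (elem i) ℤ.* b ((elem i ⁻¹) ∙ g))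
  where open FinGroup G

oneZG : (G : FinGroup) → ℤ[ G ]
oneZG G g = if g == ε then ℤ.+ 1 else ℤ.+ 0
  where open FinGroup G

underline : (G : FinGroup) → Subset G → ℤ[ G ]
underline G X g = if X g then ℤ.+ 1 else ℤ.+ 0

InSpan : (G : FinGroup) → List (Subset G) → ℤ[ G ] → Set
InSpan G S a = Σ (Fin (length S) → ℤ) λ c → ∀ g →
  a g ≡ sumFin (length S) (λ i → c i ℤ.* underline G (lookup S i) g)

record IsSRing (G : FinGroup) (S : List (Subset G)) : Set where
  open FinGroup G
  field
    nonempty  : ∀ i → ∃[ g ] (g ∈ₛ lookup S i)
    disjoint  : ∀ i j g → g ∈ₛ lookup S i → g ∈ₛ lookup S j → i ≡ j
    covering  : ∀ g → ∃[ i ] (g ∈ₛ lookup S i)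
    identity  : ∃[ i ] (∀ g → (g ∈ₛ lookup S i) ⇔ (g ≡ ε))
    inverses  : ∀ i → ∃[ j ] (∀ g → (g ∈ₛ lookup S j) ⇔ (∃[ x ] (x ∈ₛ lookup S i × g ≡ x ⁻¹)))
    -- Span_ℤ{X̲ : X ∈ S} is a subring of ℤG (it is an additive subgroup
    -- by construction; it contains 1 and is closed under multiplication)
    unitInSpan : InSpan G S (oneZG G)
    mulClosed  : ∀ a b → InSpan G S a → InSpan G S b → InSpan G S (mulZG G a b)

-- Subgroup given by an injective homomorphism ι : H → G

IsHom : (H G : FinGroup) → (Carrier H → Carrier G) → Set
IsHom H G ι = ∀ a b → ι (FinGroup._∙_ H a b) ≡ FinGroup._∙_ G (ι a) (ι b)

image : (H G : FinGroup) → (Carrier H → Carrier G) → Subset H → Subset G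
image H G ι X g = anyFin (order H) (λ i → X (FinGroup.elem H i) ∧ FinGroup._==_ G (ι (FinGroup.elem H i)) g)

complementImage : (H G : FinGroup) → (Carrier H → Carrier G) → Subset G
complementImage H G ι g = not (image H G ι (λ _ → true) g)

extendPartition : (H G : FinGroup) → (Carrier H → Carrier G) → List (Subset H) → List (Subset G)
extendPartition H G ι S₀ = map (image H G ι) S₀ ++ [ complementImage H G ι ]

IsCyclic : FinGroup → Set
IsCyclic C = ∃[ c ] ∀ x → ∃[ k ] x ≡ FinGroup._^_ C c k

module _ (H C : FinGroup) where
  private
    module H = FinGroup H
    module C = FinGroup C
    module HG = IsGroup H.isGroup
    module CG = IsGroup C.isGroup

    mul : H.Carrier × C.Carrier → H.Carrier × C.Carrier → H.Carrier × C.Carrier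
    mul (a , b) (a' , b') = (a H.∙ a') , (b C.∙ b')

    inv : H.Carrier × C.Carrier → H.Carrier × C.Carrier
    inv (a , b) = (a H.⁻¹) , (b C.⁻¹)

    e : H.Carrier × C.Carrier
    e = H.ε , C.ε

    prodIsGroup : IsGroup _≡_ mul e inv
    prodIsGroup = record
      { isMonoid = record
        { isSemigroup = record
          { isMagma = record
            { isEquivalence = isEquivalence
            ; ∙-cong = λ { refl refl → refl } }
          ; assoc = λ { (a , b) (c , d) (x , y) → cong₂ _,_ (HG.assoc a c x) (CG.assoc b d y) } }
        ; identity = (λ { (a , b) → cong₂ _,_ (proj₁ HG.identity a) (proj₁ CG.identity b) })
                   , (λ { (a , b) → cong₂ _,_ (proj₂ HG.identity a) (proj₂ CG.identity b) }) }
      ; inverse = (λ { (a , b) → cong₂ _,_ (proj₁ HG.inverse a) (proj₁ CG.inverse b) })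
                , (λ { (a , b) → cong₂ _,_ (proj₂ HG.inverse a) (proj₂ CG.inverse b) })
      ; ⁻¹-cong = λ { refl → refl } }

  _×ᴳ_ : FinGroup
  _×ᴳ_ = record
    { Carrier = H.Carrier × C.Carrier
    ; _∙_ = mul
    ; ε = e
    ; _⁻¹ = inv
    ; isGroup = prodIsGroup
    ; order = H.order ℕ.* C.order
    ; enum = ↔-trans (H.enum ×-↔ C.enum) (↔-sym *↔×) }

trivialPartition : (C : FinGroup) → List (Subset C)
trivialPartition C = (λ x → x == ε) ∷ (λ x → not (x == ε)) ∷ []
  where open FinGroup C

isIdentitySet : (C : FinGroup) → Subset C → Bool
isIdentitySet C X = allFin (FinGroup.order C) (λ i → beq (X (elem i)) (elem i == ε))
  where open FinGroup C
        beq : Bool → Bool → Bool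
        beq true  b = b
        beq false b = not b

-- Wreath product 𝒜₁ ≀ 𝒜₂ over K = H × C with L = H × {e} and K/L
-- identified with C via π(h , c) = c.  Basic sets: X × {e} for X ∈ 𝒮(𝒜₁),
-- and π⁻¹(Y) for Y ∈ 𝒮(𝒜₂), Y ≠ {e}.
wreathPartition : (H C : FinGroup) → List (Subset H) → List (Subset C) → List (Subset (H ×ᴳ C))
wreathPartition H C S₁ S₂ =
     map (λ X hc → X (proj₁ hc) ∧ FinGroup._==_ C (proj₂ hc) (FinGroup.ε C)) S₁
  ++ map (λ Y hc → Y (proj₂ hc)) (filter (λ Y → not (isIdentitySet C Y) ≟b) S₂)
  where
    _≟b : (b : Bool) → Dec (b ≡ true)
    true ≟b  = yes refl
    false ≟b = no (λ ())

Erel : (G : FinGroup) → Subset G → Carrier G → Carrier G → Set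
Erel G X u v = ∃[ g ] ∃[ x ] (x ∈ₛ X × u ≡ g × v ≡ FinGroup._∙_ G x g)

Eimage : (G₁ G₂ : FinGroup) → (Carrier G₁ → Carrier G₂) → Subset G₁ → Carrier G₂ → Carrier G₂ → Set
Eimage G₁ G₂ f X a b = ∃[ u ] ∃[ v ] (Erel G₁ X u v × a ≡ f u × b ≡ f v)

_≐₂_ : {A : Set} → (A → A → Set) → (A → A → Set) → Set
R ≐₂ Q = ∀ a b → R a b ⇔ Q a b

IsoSRing : (G₁ : FinGroup) → List (Subset G₁) → (G₂ : FinGroup) → List (Subset G₂) → Set
IsoSRing G₁ S₁ G₂ S₂ =
  Σ (Carrier G₁ ↔ Carrier G₂) λ f →
     (∀ i → ∃[ j ] (Eimage G₁ G₂ (Inverse.to f) (lookup S₁ i) ≐₂ Erel G₂ (lookup S₂ j)))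
   × (∀ j → ∃[ i ] (Eimage G₁ G₂ (Inverse.to f) (lookup S₁ i) ≐₂ Erel G₂ (lookup S₂ j)))

-- An element of ℤG lies in the span of a partition iff it is constant on the blocks. If a and b
-- are constant on ι(X) (X ∈ 𝒮₀) and on G ∖ H, then so is ab: at h ∈ H, (ab)(h) is the product of
-- the restrictions to H, which is constant on 𝒮₀ because 𝒜₀ is an S-ring, plus a term that only
-- involves the constant values outside H; at g ∉ H, the substitution x ↦ x⁻¹g shows that (ab)(g)
-- does not depend on g. For the isomorphism, a transversal T of the right cosets of H gives
-- G ≅ H × T by g = h t, and Lagrange's count |G| = |H| |T| gives |T| = m = |C|. Under G ≅ H × C, left
-- multiplication by H is left multiplication by H × {e}, and lying in the same right coset is having
-- the same C-coordinate; so E(ι X) goes to E(X × {e}) and E(G ∖ H) to E(H × (C ∖ {e})).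

module Submission where

open import Defs
open import Level using (0ℓ)
open import Algebra.Bundles using (Group; AbelianGroup)
open import Algebra.Structures using (IsGroup)
import Algebra.Properties.CommutativeMonoid.Sum as CommutativeMonoidSum
import Algebra.Properties.Group as GroupProperties
open import Data.Bool as Bool using (Bool; true; false; T; not; _∧_; _∨_; if_then_else_)
open import Data.Bool.Properties using (T-irrelevant; ∨-zeroʳ; ∧-conicalˡ; ∧-conicalʳ; not-¬; ¬-not)
open import Data.Empty using (⊥-elim)
open import Data.Fin as Fin using (Fin; combine; _↑ˡ_; _↑ʳ_)
open import Data.Fin.Permutation using (↔⇒≡)
open import Data.Fin.Properties using (*↔×; remQuot-combine; suc-injective; nonZeroIndex)
open import Data.Integer as ℤ using (ℤ; 0ℤ; _+_; -_)
import Data.Integer.Properties as ℤ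
open import Data.List using (List; length; lookup; map; _++_; [_]; _∷_; [])
open import Data.Maybe as Maybe using (Maybe; just; nothing; maybe′)
open import Data.Nat as ℕ using (ℕ; zero; suc)
import Data.Nat.Properties as ℕ
open import Data.Product as Product using (Σ; ∃-syntax; _×_; _,_; proj₁; proj₂)
open import Data.Product.Function.NonDependent.Propositional using (_×-↔_)
open import Function using (_∘_; _↔_; Inverse; mk↔ₛ′; _⇔_; mk⇔; Equivalence; id; case_of_)
open import Function.Definitions using (Injective)
open import Function.Properties.Inverse using (↔-trans; ↔-sym; ↔-refl)
open import Relation.Binary.PropositionalEquality hiding ([_])
open import Relation.Nullary using (¬_; yes; no; does; Dec)
open import Relation.Nullary.Decidable as Dec using (dec-true; dec-false; does-⇔; toWitness; fromWitness; True; isYes)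
open import Relation.Unary using (Decidable)

private
  module ∑ℤ = CommutativeMonoidSum ℤ.+-0-commutativeMonoid
  module ℤ+ = GroupProperties (AbelianGroup.group ℤ.+-0-abelianGroup)

-- Finite sums

sumFin≡sum : ∀ n (f : Fin n → ℤ) → sumFin n f ≡ ∑ℤ.sum f
sumFin≡sum zero    f = refl
sumFin≡sum (suc n) f = cong (f Fin.zero +_) (sumFin≡sum n (f ∘ Fin.suc))

sumFin-cong : ∀ n {f g : Fin n → ℤ} → f ≗ g → sumFin n f ≡ sumFin n g
sumFin-cong zero    f≗g = refl
sumFin-cong (suc n) f≗g = cong₂ _+_ (f≗g Fin.zero) (sumFin-cong n (f≗g ∘ Fin.suc))

sumFin-zero : ∀ n (f : Fin n → ℤ) → (∀ i → f i ≡ 0ℤ) → sumFin n f ≡ 0ℤ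
sumFin-zero zero    f f≡0 = refl
sumFin-zero (suc n) f f≡0 = cong₂ _+_ (f≡0 Fin.zero) (sumFin-zero n (f ∘ Fin.suc) (f≡0 ∘ Fin.suc))

sumFin-single : ∀ n (f : Fin n → ℤ) i → (∀ j → j ≢ i → f j ≡ 0ℤ) → sumFin n f ≡ f i
sumFin-single (suc n) f Fin.zero    f≡0 =
  trans (cong (f Fin.zero +_) (sumFin-zero n (f ∘ Fin.suc) λ j → f≡0 (Fin.suc j) λ ())) (ℤ.+-identityʳ _)
sumFin-single (suc n) f (Fin.suc i) f≡0 =
  trans (cong₂ _+_ (f≡0 Fin.zero λ ())
                   (sumFin-single n (f ∘ Fin.suc) i λ j j≢i → f≡0 (Fin.suc j) (j≢i ∘ suc-injective)))
        (ℤ.+-identityˡ _)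

sumFin-++ : ∀ k n (f : Fin (k ℕ.+ n) → ℤ) →
            sumFin (k ℕ.+ n) f ≡ sumFin k (f ∘ (_↑ˡ n)) + sumFin n (f ∘ (k ↑ʳ_))
sumFin-++ zero    n f = sym (ℤ.+-identityˡ _)
sumFin-++ (suc k) n f =
  trans (cong (f Fin.zero +_) (sumFin-++ k n (f ∘ Fin.suc))) (sym (ℤ.+-assoc (f Fin.zero) _ _))

sumFin-combine : ∀ n k (f : Fin (n ℕ.* k) → ℤ) →
                 sumFin (n ℕ.* k) f ≡ sumFin n (λ a → sumFin k (λ b → f (combine a b)))
sumFin-combine zero    k f = refl
sumFin-combine (suc n) k f =
  trans (sumFin-++ k (n ℕ.* k) f) (cong (sumFin k (f ∘ (_↑ˡ n ℕ.* k)) +_) (sumFin-combine n k (f ∘ (k ↑ʳ_))))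

sumFin-permute : ∀ {m n} (f : Fin n → ℤ) (π : Fin m ↔ Fin n) → sumFin n f ≡ sumFin m (f ∘ Inverse.to π)
sumFin-permute {m} {n} f π =
  trans (sumFin≡sum n f) (trans (∑ℤ.sum-permute f π) (sym (sumFin≡sum m (f ∘ Inverse.to π))))

sumFin-distrib-+ : ∀ n (f g : Fin n → ℤ) → sumFin n (λ i → f i + g i) ≡ sumFin n f + sumFin n g
sumFin-distrib-+ n f g = begin
  sumFin n (λ i → f i + g i)   ≡⟨ sumFin≡sum n _ ⟩
  ∑ℤ.sum (λ i → f i + g i)     ≡⟨ ∑ℤ.∑-distrib-+ f g ⟩
  ∑ℤ.sum f + ∑ℤ.sum g          ≡⟨ sym (cong₂ _+_ (sumFin≡sum n f) (sumFin≡sum n g)) ⟩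
  sumFin n f + sumFin n g      ∎
  where open ≡-Reasoning

∑⟨_⟩ : {A : Set} {n : ℕ} → A ↔ Fin n → (A → ℤ) → ℤ
∑⟨ e ⟩ F = sumFin _ (F ∘ Inverse.from e)

module _ {A : Set} {n : ℕ} (e : A ↔ Fin n) where

  ∑-cong : {F F′ : A → ℤ} → F ≗ F′ → ∑⟨ e ⟩ F ≡ ∑⟨ e ⟩ F′
  ∑-cong F≗F′ = sumFin-cong n (F≗F′ ∘ Inverse.from e)

  ∑-distrib-+ : (F F′ : A → ℤ) → ∑⟨ e ⟩ (λ x → F x + F′ x) ≡ ∑⟨ e ⟩ F + ∑⟨ e ⟩ F′
  ∑-distrib-+ F F′ = sumFin-distrib-+ n (F ∘ Inverse.from e) (F′ ∘ Inverse.from e)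

  ∑-single : (F : A → ℤ) (x₀ : A) → (∀ x → x ≢ x₀ → F x ≡ 0ℤ) → ∑⟨ e ⟩ F ≡ F x₀
  ∑-single F x₀ F≡0 =
    trans (sumFin-single n (F ∘ Inverse.from e) (Inverse.to e x₀) off-x₀)
          (cong F (Inverse.strictlyInverseʳ e x₀))
    where
    off-x₀ : ∀ i → i ≢ Inverse.to e x₀ → F (Inverse.from e i) ≡ 0ℤ
    off-x₀ i i≢ = F≡0 _ λ eq → i≢ (trans (sym (Inverse.strictlyInverseˡ e i)) (cong (Inverse.to e) eq))

  ∑-enumeration-irrelevant : ∀ {m} (e′ : A ↔ Fin m) (F : A → ℤ) → ∑⟨ e ⟩ F ≡ ∑⟨ e′ ⟩ F
  ∑-enumeration-irrelevant {m} e′ F =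
    trans (sumFin-permute (F ∘ Inverse.from e) (↔-trans (↔-sym e′) e))
          (sumFin-cong m λ i → cong F (Inverse.strictlyInverseʳ e (Inverse.from e′ i)))

  ∑-reindex : (φ : A ↔ A) (F : A → ℤ) → ∑⟨ e ⟩ (F ∘ Inverse.to φ) ≡ ∑⟨ e ⟩ F
  ∑-reindex φ F = sym (∑-enumeration-irrelevant (↔-trans (↔-sym φ) e) F)

_×ₑ_ : {A B : Set} {n k : ℕ} → A ↔ Fin n → B ↔ Fin k → (A × B) ↔ Fin (n ℕ.* k)
e ×ₑ e′ = ↔-trans (e ×-↔ e′) (↔-sym *↔×)

∑-× : {A B : Set} {n k : ℕ} (e : A ↔ Fin n) (e′ : B ↔ Fin k) (F : A × B → ℤ) →
      ∑⟨ e ×ₑ e′ ⟩ F ≡ ∑⟨ e ⟩ (λ a → ∑⟨ e′ ⟩ (λ b → F (a , b)))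
∑-× {n = n} {k} e e′ F =
  trans (sumFin-combine n k _)
        (sumFin-cong n λ a → sumFin-cong k λ b →
           cong (λ p → F (Inverse.from e (proj₁ p) , Inverse.from e′ (proj₂ p))) (remQuot-combine a b))

-- Searching and counting in Fin

firstIndex : ∀ {n} {P : Fin n → Set} → Decidable P → Maybe (Fin n)
firstIndex {zero}  P? = nothing
firstIndex {suc n} P? =
  if does (P? Fin.zero) then just Fin.zero else Maybe.map Fin.suc (firstIndex (P? ∘ Fin.suc))

firstIndex-just : ∀ {n} {P : Fin n → Set} (P? : Decidable P) {i} → firstIndex P? ≡ just i → P i
firstIndex-just {suc n} P? eq with P? Fin.zero | firstIndex (P? ∘ Fin.suc) in rest
firstIndex-just {suc n} P? refl | yes p₀ | _      = p₀
firstIndex-just {suc n} P? refl | no _   | just j = firstIndex-just (P? ∘ Fin.suc) rest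

firstIndex-nothing : ∀ {n} {P : Fin n → Set} (P? : Decidable P) → firstIndex P? ≡ nothing → ∀ i → ¬ P i
firstIndex-nothing {suc n} P? eq i with P? Fin.zero | firstIndex (P? ∘ Fin.suc) in rest
firstIndex-nothing {suc n} P? refl Fin.zero    | no ¬p₀ | nothing = ¬p₀
firstIndex-nothing {suc n} P? refl (Fin.suc i) | no _   | nothing = firstIndex-nothing (P? ∘ Fin.suc) rest i

firstIndex-zero : ∀ {n} {P : Fin (suc n) → Set} (P? : Decidable P) → P Fin.zero → firstIndex P? ≡ just Fin.zero
firstIndex-zero P? p₀ rewrite dec-true (P? Fin.zero) p₀ = refl

firstIndex-cong : ∀ {n} {P Q : Fin n → Set} (P? : Decidable P) (Q? : Decidable Q) →
                  (∀ i → P i ⇔ Q i) → firstIndex P? ≡ firstIndex Q?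
firstIndex-cong {zero}  P? Q? P⇔Q = refl
firstIndex-cong {suc n} P? Q? P⇔Q =
  cong₂ (λ b r → if b then just Fin.zero else Maybe.map Fin.suc r)
        (does-⇔ (P⇔Q Fin.zero) (P? Fin.zero) (Q? Fin.zero))
        (firstIndex-cong (P? ∘ Fin.suc) (Q? ∘ Fin.suc) (P⇔Q ∘ Fin.suc))

enumerateSubset : ∀ {n} (p : Fin n → Bool) → ∃[ k ] (Σ (Fin n) (T ∘ p) ↔ Fin k)
enumerateSubset {zero}  p = 0 , mk↔ₛ′ (λ ()) (λ ()) (λ ()) (λ ())
enumerateSubset {suc n} p with enumerateSubset (p ∘ Fin.suc)
... | k , φ with p Fin.zero in p₀
...   | true = suc k , mk↔ₛ′ to from to∘from from∘to
  where
  to : Σ (Fin (suc n)) (T ∘ p) → Fin (suc k)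
  to (Fin.zero  , _) = Fin.zero
  to (Fin.suc i , t) = Fin.suc (Inverse.to φ (i , t))
  from : Fin (suc k) → Σ (Fin (suc n)) (T ∘ p)
  from Fin.zero    = Fin.zero , subst T (sym p₀) _
  from (Fin.suc j) = Product.map Fin.suc id (Inverse.from φ j)
  to∘from : ∀ j → to (from j) ≡ j
  to∘from Fin.zero    = refl
  to∘from (Fin.suc j) = cong Fin.suc (Inverse.strictlyInverseˡ φ j)
  from∘to : ∀ x → from (to x) ≡ x
  from∘to (Fin.zero  , t) = cong (Fin.zero ,_) (T-irrelevant _ t)
  from∘to (Fin.suc i , t) = cong (Product.map Fin.suc id) (Inverse.strictlyInverseʳ φ (i , t))
...   | false = k , mk↔ₛ′ to from (Inverse.strictlyInverseˡ φ) from∘to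
  where
  to : Σ (Fin (suc n)) (T ∘ p) → Fin k
  to (Fin.zero  , t) = ⊥-elim (subst T p₀ t)
  to (Fin.suc i , t) = Inverse.to φ (i , t)
  from : Fin k → Σ (Fin (suc n)) (T ∘ p)
  from = Product.map Fin.suc id ∘ Inverse.from φ
  from∘to : ∀ x → from (to x) ≡ x
  from∘to (Fin.zero  , t) = ⊥-elim (subst T p₀ t)
  from∘to (Fin.suc i , t) = cong (Product.map Fin.suc id) (Inverse.strictlyInverseʳ φ (i , t))

anyFin-sound : ∀ n (p : Fin n → Bool) → anyFin n p ≡ true → ∃[ i ] p i ≡ true
anyFin-sound (suc n) p eq with p Fin.zero in p₀
... | true  = Fin.zero , p₀
... | false = Product.map Fin.suc id (anyFin-sound n (p ∘ Fin.suc) eq)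

anyFin-complete : ∀ n (p : Fin n → Bool) {i} → p i ≡ true → anyFin n p ≡ true
anyFin-complete (suc n) p {Fin.zero}  pᵢ rewrite pᵢ = refl
anyFin-complete (suc n) p {Fin.suc i} pᵢ =
  trans (cong (p Fin.zero ∨_) (anyFin-complete n (p ∘ Fin.suc) pᵢ)) (∨-zeroʳ _)

allFin-sound : ∀ n (p : Fin n → Bool) → allFin n p ≡ true → ∀ i → p i ≡ true
allFin-sound (suc n) p eq Fin.zero    = ∧-conicalˡ _ _ eq
allFin-sound (suc n) p eq (Fin.suc i) = allFin-sound n (p ∘ Fin.suc) (∧-conicalʳ _ _ eq) i

allFin-false : ∀ n (p : Fin n → Bool) → allFin n p ≡ false → ∃[ i ] p i ≡ false
allFin-false (suc n) p eq with p Fin.zero in p₀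
... | false = Fin.zero , p₀
... | true  = Product.map Fin.suc id (allFin-false n (p ∘ Fin.suc) eq)

-- Partitions and the span of their blocks

module MapSnoc {A B : Set} (f : A → B) (y : B) where

  mapSnoc : List A → List B
  mapSnoc xs = map f xs ++ [ y ]

  innerIndex : ∀ xs → Fin (length xs) → Fin (length (mapSnoc xs))
  innerIndex (x ∷ xs) Fin.zero    = Fin.zero
  innerIndex (x ∷ xs) (Fin.suc j) = Fin.suc (innerIndex xs j)

  lastIndex : ∀ xs → Fin (length (mapSnoc xs))
  lastIndex []       = Fin.zero
  lastIndex (x ∷ xs) = Fin.suc (lastIndex xs)

  lookup-innerIndex : ∀ xs j → lookup (mapSnoc xs) (innerIndex xs j) ≡ f (lookup xs j)
  lookup-innerIndex (x ∷ xs) Fin.zero    = refl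
  lookup-innerIndex (x ∷ xs) (Fin.suc j) = lookup-innerIndex xs j

  lookup-lastIndex : ∀ xs → lookup (mapSnoc xs) (lastIndex xs) ≡ y
  lookup-lastIndex []       = refl
  lookup-lastIndex (x ∷ xs) = lookup-lastIndex xs

  data Position (xs : List A) : Fin (length (mapSnoc xs)) → Set where
    inner : ∀ j → Position xs (innerIndex xs j)
    last  : Position xs (lastIndex xs)

  position : ∀ xs i → Position xs i
  position []       Fin.zero    = last
  position (x ∷ xs) Fin.zero    = inner Fin.zero
  position (x ∷ xs) (Fin.suc i) with position xs i
  ... | inner j = inner (Fin.suc j)
  ... | last    = last

module Partition (K : FinGroup) (S : List (Subset K))
  (disjoint : ∀ i j g → g ∈ₛ lookup S i → g ∈ₛ lookup S j → i ≡ j) where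

  open import Data.Integer using (_*_)

  BlockConstant : ℤ[ K ] → Set
  BlockConstant a = ∀ i {g g′} → g ∈ₛ lookup S i → g′ ∈ₛ lookup S i → a g ≡ a g′

  combination-on-block : ∀ (c : Fin (length S) → ℤ) {g} i → g ∈ₛ lookup S i →
    sumFin (length S) (λ j → c j * underline K (lookup S j) g) ≡ c i
  combination-on-block c {g} i g∈Sᵢ = trans (sumFin-single (length S) _ i off-block) on-block
    where
    on-block : c i * underline K (lookup S i) g ≡ c i
    on-block rewrite g∈Sᵢ = ℤ.*-identityʳ (c i)
    off-block : ∀ j → j ≢ i → c j * underline K (lookup S j) g ≡ 0ℤ
    off-block j j≢i with lookup S j g in g∈Sⱼ
    ... | true  = ⊥-elim (j≢i (disjoint j i g g∈Sⱼ g∈Sᵢ))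
    ... | false = ℤ.*-zeroʳ (c j)

  inSpan⇒blockConstant : ∀ {a} → InSpan K S a → BlockConstant a
  inSpan⇒blockConstant (c , a≡) i g∈Sᵢ g′∈Sᵢ =
    trans (a≡ _) (trans (combination-on-block c i g∈Sᵢ) (sym (trans (a≡ _) (combination-on-block c i g′∈Sᵢ))))

  blockConstant⇒inSpan : (∀ i → ∃[ g ] g ∈ₛ lookup S i) → (∀ g → ∃[ i ] g ∈ₛ lookup S i) →
    ∀ {a} → BlockConstant a → InSpan K S a
  blockConstant⇒inSpan nonempty covering {a} a-const = value , λ g →
    let (i , g∈Sᵢ) = covering g in
    trans (a-const i g∈Sᵢ (proj₂ (nonempty i))) (sym (combination-on-block value i g∈Sᵢ))
    where
    value : Fin (length S) → ℤ
    value i = a (proj₁ (nonempty i))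

-- Groups, subgroups and cosets

asGroup : FinGroup → Group 0ℓ 0ℓ
asGroup K = record { isGroup = FinGroup.isGroup K }

module FinGroupProperties (K : FinGroup) where
  open FinGroup K public
  open IsGroup isGroup public using (assoc; identityˡ; identityʳ; inverseˡ; inverseʳ; _\\_; _//_)
  open GroupProperties (asGroup K) public

  \\-↔ : Carrier K → Carrier K ↔ Carrier K
  \\-↔ g = mk↔ₛ′ (_\\ g) (g //_) to∘from from∘to
    where
    to∘from : ∀ y → (g // y) \\ g ≡ y
    to∘from y = trans (cong (_∙ g) (⁻¹-anti-homo-// g y)) (//-rightDividesˡ g y)
    from∘to : ∀ x → g // (x \\ g) ≡ x
    from∘to x = trans (cong (g ∙_) (⁻¹-anti-homo-\\ x g)) (\\-leftDividesˡ g x)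

  ==⇒≡ : ∀ {a b} → (a == b) ≡ true → a ≡ b
  ==⇒≡ {a} {b} eq with a ≟ b
  ... | yes a≡b = a≡b

  ≡⇒== : ∀ {a b} → a ≡ b → (a == b) ≡ true
  ≡⇒== {a} {b} = dec-true (a ≟ b)

  elem-to : ∀ x → elem (Inverse.to enum x) ≡ x
  elem-to = Inverse.strictlyInverseʳ enum

  elem-injective : ∀ {i j} → elem i ≡ elem j → i ≡ j
  elem-injective {i} {j} eq =
    trans (sym (Inverse.strictlyInverseˡ enum i)) (trans (cong (Inverse.to enum) eq) (Inverse.strictlyInverseˡ enum j))

module ImageProperties (H G : FinGroup) (ι : Carrier H → Carrier G) where
  private
    module H = FinGroup H
    module G = FinGroupProperties G

  image-sound : ∀ X {g} → image H G ι X g ≡ true → ∃[ h ] (X h ≡ true × ι h ≡ g)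
  image-sound X eq with anyFin-sound (order H) _ eq
  ... | i , Xᵢ∧ιᵢ==g = H.elem i , ∧-conicalˡ _ _ Xᵢ∧ιᵢ==g , G.==⇒≡ (∧-conicalʳ _ _ Xᵢ∧ιᵢ==g)

  image-complete : ∀ X {h} → X h ≡ true → image H G ι X (ι h) ≡ true
  image-complete X {h} Xh = anyFin-complete (order H) _ {Inverse.to H.enum h}
    (subst (λ y → X y ∧ (ι y G.== ι h) ≡ true) (sym (Inverse.strictlyInverseʳ H.enum h))
           (cong₂ _∧_ Xh (G.≡⇒== refl)))

module Subgroup (G H : FinGroup) (ι : Carrier H → Carrier G)
  (ι-hom : IsHom H G ι) (ι-inj : Injective _≡_ _≡_ ι) where

  module G = FinGroupProperties G
  module H = FinGroupProperties H
  open G using (_∙_; _⁻¹; ε)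
  open ImageProperties H G ι

  ι-ε : ι H.ε ≡ ε
  ι-ε = G.identityˡ-unique (ι H.ε) (ι H.ε) (trans (sym (ι-hom H.ε H.ε)) (cong ι (H.identityˡ H.ε)))

  ι-⁻¹ : ∀ h → ι (h H.⁻¹) ≡ ι h ⁻¹
  ι-⁻¹ h = G.inverseˡ-unique _ _ (trans (sym (ι-hom (h H.⁻¹) h)) (trans (cong ι (H.inverseˡ h)) ι-ε))

  infix 4 _∈H _∉H
  _∈H : Carrier G → Set
  g ∈H = ∃[ h ] ι h ≡ g

  _∉H : Carrier G → Set
  g ∉H = ¬ g ∈H

  ∈H-ε : ε ∈H
  ∈H-ε = H.ε , ι-ε

  ∈H-∙ : ∀ {x y} → x ∈H → y ∈H → x ∙ y ∈H
  ∈H-∙ (a , refl) (b , refl) = a H.∙ b , ι-hom a b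

  ∈H-⁻¹ : ∀ {x} → x ∈H → x ⁻¹ ∈H
  ∈H-⁻¹ (a , refl) = a H.⁻¹ , ι-⁻¹ a

  ∉H-⁻¹ : ∀ {x} → x ∉H → x ⁻¹ ∉H
  ∉H-⁻¹ {x} x∉H x⁻¹∈H = x∉H (subst _∈H (G.⁻¹-involutive x) (∈H-⁻¹ x⁻¹∈H))

  ∉H-∙ˡ : ∀ {x y} → y ∈H → x ∉H → y ∙ x ∉H
  ∉H-∙ˡ {x} {y} y∈H x∉H yx∈H = x∉H (subst _∈H (G.\\-leftDividesʳ y x) (∈H-∙ (∈H-⁻¹ y∈H) yx∈H))

  ∉H-∙ʳ : ∀ {x y} → x ∉H → y ∈H → x ∙ y ∉H
  ∉H-∙ʳ {x} {y} x∉H y∈H xy∈H = x∉H (subst _∈H (G.//-rightDividesʳ y x) (∈H-∙ xy∈H (∈H-⁻¹ y∈H)))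

  fullImage⇔∈H : ∀ g → image H G ι (λ _ → true) g ≡ true ⇔ g ∈H
  fullImage⇔∈H g = mk⇔ (λ eq → let (h , _ , ιh≡g) = image-sound (λ _ → true) eq in h , ιh≡g)
                       (λ { (h , refl) → image-complete (λ _ → true) refl })

  -- Opaque so that `with x ∈H?` can abstract over the decision: unfolded, `does (x ∈H?)`
  -- reduces to a Boolean computed by `image` and the abstraction no longer matches.
  opaque
    _∈H? : Decidable _∈H
    g ∈H? = Dec.map (fullImage⇔∈H g) (image H G ι (λ _ → true) g Bool.≟ true)

  complementImage⇔∉H : ∀ g → complementImage H G ι g ≡ true ⇔ g ∉H
  complementImage⇔∉H g = mk⇔ (λ ¬b g∈H → not-¬ (sym (from g∈H)) (sym ¬b))
                             (λ g∉H → sym (¬-not (g∉H ∘ to ∘ sym)))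
    where open Equivalence (fullImage⇔∈H g)

  infix 4 _∼_ _∼?_
  _∼_ : Carrier G → Carrier G → Set
  x ∼ y = x ∙ y ⁻¹ ∈H

  _∼?_ : ∀ x y → Dec (x ∼ y)
  x ∼? y = (x ∙ y ⁻¹) ∈H?

  ∼-refl : ∀ x → x ∼ x
  ∼-refl x = subst _∈H (sym (G.inverseʳ x)) ∈H-ε

  ∼-sym : ∀ {x y} → x ∼ y → y ∼ x
  ∼-sym {x} {y} x∼y = subst _∈H (begin
    (x ∙ y ⁻¹) ⁻¹        ≡⟨ G.⁻¹-anti-homo-∙ x (y ⁻¹) ⟩
    y ⁻¹ ⁻¹ ∙ x ⁻¹       ≡⟨ cong (_∙ x ⁻¹) (G.⁻¹-involutive y) ⟩
    y ∙ x ⁻¹             ∎) (∈H-⁻¹ x∼y)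
    where open ≡-Reasoning

  ∼-trans : ∀ {x y z} → x ∼ y → y ∼ z → x ∼ z
  ∼-trans {x} {y} {z} x∼y y∼z = subst _∈H (begin
    (x ∙ y ⁻¹) ∙ (y ∙ z ⁻¹)  ≡⟨ G.assoc x (y ⁻¹) (y ∙ z ⁻¹) ⟩
    x ∙ (y ⁻¹ ∙ (y ∙ z ⁻¹))  ≡⟨ cong (x ∙_) (G.\\-leftDividesʳ y (z ⁻¹)) ⟩
    x ∙ z ⁻¹                 ∎) (∈H-∙ x∼y y∼z)
    where open ≡-Reasoning

  ι∙-∼ : ∀ h x → ι h ∙ x ∼ x
  ι∙-∼ h x = h , sym (G.//-rightDividesʳ x (ι h))

  ∙-∼⇒∈H : ∀ {x g} → x ∙ g ∼ g → x ∈H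
  ∙-∼⇒∈H {x} {g} = subst _∈H (G.//-rightDividesʳ g x)

  -- rep g is the first of ε, elem 0, elem 1, … lying in the coset H g; trying ε first makes ε the
  -- representative of H itself.
  candidate : Fin (suc (order G)) → Carrier G
  candidate Fin.zero    = ε
  candidate (Fin.suc i) = G.elem i

  opaque
    rep : Carrier G → Carrier G
    rep g = maybe′ candidate ε (firstIndex (λ i → candidate i ∼? g))

    rep-∼ : ∀ g → rep g ∼ g
    rep-∼ g with firstIndex (λ i → candidate i ∼? g) in found
    ... | just i  = firstIndex-just (λ i → candidate i ∼? g) found
    ... | nothing = ⊥-elim (firstIndex-nothing (λ i → candidate i ∼? g) found (Fin.suc (Inverse.to G.enum g))
                             (subst (_∼ g) (sym (G.elem-to g)) (∼-refl g)))

    rep-cong : ∀ {x y} → x ∼ y → rep x ≡ rep y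
    rep-cong x∼y = cong (maybe′ candidate ε)
      (firstIndex-cong (λ i → candidate i ∼? _) (λ i → candidate i ∼? _)
                       λ i → mk⇔ (λ c∼x → ∼-trans c∼x x∼y) (λ c∼y → ∼-trans c∼y (∼-sym x∼y)))

    rep-∈H : ∀ {g} → g ∈H → rep g ≡ ε
    rep-∈H {g} g∈H =
      cong (maybe′ candidate ε)
           (firstIndex-zero (λ i → candidate i ∼? g) (subst _∈H (sym (G.identityˡ (g ⁻¹))) (∈H-⁻¹ g∈H)))

  Transversal : Set
  Transversal = Σ (Fin (order G)) (λ i → True (rep (G.elem i) G.≟ G.elem i))

  ⟦_⟧ : Transversal → Carrier G
  ⟦ i , _ ⟧ = G.elem i

  rep-⟦⟧ : ∀ r → rep ⟦ r ⟧ ≡ ⟦ r ⟧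
  rep-⟦⟧ (_ , isRep) = toWitness isRep

  ⟦⟧-injective : ∀ {r r′} → ⟦ r ⟧ ≡ ⟦ r′ ⟧ → r ≡ r′
  ⟦⟧-injective {i , isRep} {i′ , isRep′} eq with G.elem-injective eq
  ... | refl = cong (i ,_) (T-irrelevant isRep isRep′)

  representative : Carrier G → Transversal
  representative g = Inverse.to G.enum (rep g) ,
    subst (λ x → True (rep x G.≟ x)) (sym (G.elem-to (rep g))) (fromWitness (rep-cong (rep-∼ g)))

  ⟦representative⟧ : ∀ g → ⟦ representative g ⟧ ≡ rep g
  ⟦representative⟧ g = G.elem-to (rep g)

  representative-cong : ∀ {x y} → x ∼ y → representative x ≡ representative y
  representative-cong x∼y =
    ⟦⟧-injective (trans (⟦representative⟧ _) (trans (rep-cong x∼y) (sym (⟦representative⟧ _))))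

  representative-≡⇒∼ : ∀ {x y} → representative x ≡ representative y → x ∼ y
  representative-≡⇒∼ {x} {y} eq = ∼-trans (∼-sym (rep-∼ x)) (subst (_∼ y) same-rep (rep-∼ y))
    where
    same-rep : rep y ≡ rep x
    same-rep = trans (sym (⟦representative⟧ y)) (trans (cong ⟦_⟧ (sym eq)) (⟦representative⟧ x))

  representative-⟦⟧ : ∀ r → representative ⟦ r ⟧ ≡ r
  representative-⟦⟧ r = ⟦⟧-injective (trans (⟦representative⟧ ⟦ r ⟧) (rep-⟦⟧ r))

  ⟦⟧∈H : ∀ {r} → ⟦ r ⟧ ∈H → r ≡ representative ε
  ⟦⟧∈H {r} r∈H = ⟦⟧-injective (begin
    ⟦ r ⟧                     ≡⟨ rep-⟦⟧ r ⟨
    rep ⟦ r ⟧                 ≡⟨ rep-∈H r∈H ⟩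
    ε                         ≡⟨ rep-∈H ∈H-ε ⟨
    rep ε                     ≡⟨ ⟦representative⟧ ε ⟨
    ⟦ representative ε ⟧      ∎)
    where open ≡-Reasoning

  opaque
    cosetPart : Carrier G → Carrier H
    cosetPart g = proj₁ (∼-sym (rep-∼ g))

    ι-cosetPart : ∀ g → ι (cosetPart g) ≡ g ∙ rep g ⁻¹
    ι-cosetPart g = proj₂ (∼-sym (rep-∼ g))

  cosetPart-ι∙ : ∀ h x → cosetPart (ι h ∙ x) ≡ h H.∙ cosetPart x
  cosetPart-ι∙ h x = ι-inj (begin
    ι (cosetPart (ι h ∙ x))      ≡⟨ ι-cosetPart (ι h ∙ x) ⟩
    (ι h ∙ x) ∙ rep (ι h ∙ x) ⁻¹  ≡⟨ cong (λ r → (ι h ∙ x) ∙ r ⁻¹) (rep-cong (ι∙-∼ h x)) ⟩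
    (ι h ∙ x) ∙ rep x ⁻¹          ≡⟨ G.assoc (ι h) x (rep x ⁻¹) ⟩
    ι h ∙ (x ∙ rep x ⁻¹)          ≡⟨ cong (ι h ∙_) (ι-cosetPart x) ⟨
    ι h ∙ ι (cosetPart x)         ≡⟨ ι-hom h (cosetPart x) ⟨
    ι (h H.∙ cosetPart x)         ∎)
    where open ≡-Reasoning

  cosetPart-⟦⟧ : ∀ r → cosetPart ⟦ r ⟧ ≡ H.ε
  cosetPart-⟦⟧ r = ι-inj (begin
    ι (cosetPart ⟦ r ⟧)      ≡⟨ ι-cosetPart ⟦ r ⟧ ⟩
    ⟦ r ⟧ ∙ rep ⟦ r ⟧ ⁻¹     ≡⟨ cong (λ x → ⟦ r ⟧ ∙ x ⁻¹) (rep-⟦⟧ r) ⟩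
    ⟦ r ⟧ ∙ ⟦ r ⟧ ⁻¹         ≡⟨ G.inverseʳ ⟦ r ⟧ ⟩
    ε                        ≡⟨ ι-ε ⟨
    ι H.ε                    ∎)
    where open ≡-Reasoning

  cosetDecomposition : Carrier G ↔ (Carrier H × Transversal)
  cosetDecomposition = mk↔ₛ′ to from to∘from from∘to
    where
    to : Carrier G → Carrier H × Transversal
    to g = cosetPart g , representative g
    from : Carrier H × Transversal → Carrier G
    from (h , r) = ι h ∙ ⟦ r ⟧
    to∘from : ∀ p → to (from p) ≡ p
    to∘from (h , r) = cong₂ _,_
      (trans (cosetPart-ι∙ h ⟦ r ⟧) (trans (cong (h H.∙_) (cosetPart-⟦⟧ r)) (H.identityʳ h)))
      (trans (representative-cong (ι∙-∼ h ⟦ r ⟧)) (representative-⟦⟧ r))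
    from∘to : ∀ g → from (to g) ≡ g
    from∘to g = trans (cong₂ _∙_ (ι-cosetPart g) (⟦representative⟧ g)) (G.//-rightDividesˡ (rep g) g)

  opaque
    index : ℕ
    index = proj₁ (enumerateSubset (λ i → isYes (rep (G.elem i) G.≟ G.elem i)))

    transversalEnum : Transversal ↔ Fin index
    transversalEnum = proj₂ (enumerateSubset (λ i → isYes (rep (G.elem i) G.≟ G.elem i)))

  lagrange : order G ≡ order H ℕ.* index
  lagrange = ↔⇒≡ (↔-trans (↔-sym G.enum) (↔-trans cosetDecomposition (H.enum ×ₑ transversalEnum)))

  ∑G : (Carrier G → ℤ) → ℤ
  ∑G = ∑⟨ G.enum ⟩

  ∑H : (Carrier H → ℤ) → ℤ
  ∑H = ∑⟨ H.enum ⟩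

  inside outside : (Carrier G → ℤ) → Carrier G → ℤ
  inside  F x = if does (x ∈H?) then F x else 0ℤ
  outside F x = if does (x ∈H?) then 0ℤ else F x

  ∑-inside : ∀ F → ∑G (inside F) ≡ ∑H (F ∘ ι)
  ∑-inside F = begin
    ∑G (inside F)
      ≡⟨ ∑-enumeration-irrelevant G.enum (↔-trans cosetDecomposition (H.enum ×ₑ transversalEnum)) (inside F) ⟩
    ∑⟨ H.enum ×ₑ transversalEnum ⟩ (λ (h , r) → inside F (ι h ∙ ⟦ r ⟧))
      ≡⟨ ∑-× H.enum transversalEnum (λ (h , r) → inside F (ι h ∙ ⟦ r ⟧)) ⟩
    ∑H (λ h → ∑⟨ transversalEnum ⟩ (λ r → inside F (ι h ∙ ⟦ r ⟧)))
      ≡⟨ ∑-cong H.enum (λ h → ∑-single transversalEnum _ (representative ε) (off-H h)) ⟩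
    ∑H (λ h → inside F (ι h ∙ ⟦ representative ε ⟧))
      ≡⟨ ∑-cong H.enum on-H ⟩
    ∑H (F ∘ ι)
      ∎
    where
    open ≡-Reasoning
    off-H : ∀ h r → r ≢ representative ε → inside F (ι h ∙ ⟦ r ⟧) ≡ 0ℤ
    off-H h r r≢ with (ι h ∙ ⟦ r ⟧) ∈H?
    ... | yes ι∙r∈H =
      ⊥-elim (r≢ (⟦⟧∈H (subst _∈H (G.\\-leftDividesʳ (ι h) ⟦ r ⟧) (∈H-∙ (∈H-⁻¹ (h , refl)) ι∙r∈H))))
    ... | no  _     = refl
    on-H : ∀ h → inside F (ι h ∙ ⟦ representative ε ⟧) ≡ F (ι h)
    on-H h rewrite ⟦representative⟧ ε | rep-∈H ∈H-ε | G.identityʳ (ι h) with ι h ∈H?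
    ... | yes _   = refl
    ... | no  ∉H  = ⊥-elim (∉H (h , refl))

  ∑-split : ∀ F → ∑G F ≡ ∑H (F ∘ ι) + ∑G (outside F)
  ∑-split F = begin
    ∑G F                                ≡⟨ ∑-cong G.enum inside+outside ⟩
    ∑G (λ x → inside F x + outside F x) ≡⟨ ∑-distrib-+ G.enum (inside F) (outside F) ⟩
    ∑G (inside F) + ∑G (outside F)      ≡⟨ cong (_+ ∑G (outside F)) (∑-inside F) ⟩
    ∑H (F ∘ ι) + ∑G (outside F)         ∎
    where
    open ≡-Reasoning
    inside+outside : ∀ x → F x ≡ inside F x + outside F x
    inside+outside x with x ∈H?
    ... | yes _ = sym (ℤ.+-identityʳ (F x))
    ... | no  _ = sym (ℤ.+-identityˡ (F x))

  ∑-outside-cong : ∀ {F F′} → (∀ x → x ∉H → F x ≡ F′ x) → ∑G (outside F) ≡ ∑G (outside F′)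
  ∑-outside-cong {F} {F′} F≡F′ = ∑-cong G.enum outside-cong
    where
    outside-cong : ∀ x → outside F x ≡ outside F′ x
    outside-cong x with x ∈H?
    ... | yes _   = refl
    ... | no  x∉H = F≡F′ x x∉H

-- The extended partition is an S-ring

module Extension (G H : FinGroup) (ι : Carrier H → Carrier G)
  (ι-hom : IsHom H G ι) (ι-inj : Injective _≡_ _≡_ ι)
  (g₀ : Carrier G) (ι≢g₀ : ∀ h → ι h ≢ g₀)
  (S₀ : List (Subset H)) (A₀ : IsSRing H S₀) where

  open Subgroup G H ι ι-hom ι-inj
  open ImageProperties H G ι
  open MapSnoc (image H G ι) (complementImage H G ι)
  open G using (_∙_; _⁻¹; ε)
  module A₀ = IsSRing A₀

  S : List (Subset G)
  S = extendPartition H G ι S₀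

  ∈-inner⇒ : ∀ j {g} → g ∈ₛ lookup S (innerIndex S₀ j) → ∃[ h ] (h ∈ₛ lookup S₀ j × ι h ≡ g)
  ∈-inner⇒ j {g} g∈ = image-sound (lookup S₀ j) (subst (λ X → X g ≡ true) (lookup-innerIndex S₀ j) g∈)

  ∈-inner⇐ : ∀ j {h} → h ∈ₛ lookup S₀ j → ι h ∈ₛ lookup S (innerIndex S₀ j)
  ∈-inner⇐ j {h} h∈ =
    subst (λ X → X (ι h) ≡ true) (sym (lookup-innerIndex S₀ j)) (image-complete (lookup S₀ j) h∈)

  ∈-last⇒∉H : ∀ {g} → g ∈ₛ lookup S (lastIndex S₀) → g ∉H
  ∈-last⇒∉H {g} g∈ =
    Equivalence.to (complementImage⇔∉H g) (subst (λ X → X g ≡ true) (lookup-lastIndex S₀) g∈)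

  ∉H⇒∈-last : ∀ {g} → g ∉H → g ∈ₛ lookup S (lastIndex S₀)
  ∉H⇒∈-last {g} g∉H =
    subst (λ X → X g ≡ true) (sym (lookup-lastIndex S₀)) (Equivalence.from (complementImage⇔∉H g) g∉H)

  ∈-inner⇒∈H : ∀ j {g} → g ∈ₛ lookup S (innerIndex S₀ j) → g ∈H
  ∈-inner⇒∈H j g∈ = let (h , _ , ιh≡g) = ∈-inner⇒ j g∈ in h , ιh≡g

  g₀∉H : g₀ ∉H
  g₀∉H (h , ιh≡g₀) = ι≢g₀ h ιh≡g₀

  nonempty : ∀ i → ∃[ g ] g ∈ₛ lookup S i
  nonempty i with position S₀ i
  ... | inner j = let (h , h∈) = A₀.nonempty j in ι h , ∈-inner⇐ j h∈
  ... | last    = g₀ , ∉H⇒∈-last g₀∉H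

  disjoint : ∀ i i′ g → g ∈ₛ lookup S i → g ∈ₛ lookup S i′ → i ≡ i′
  disjoint i i′ g g∈ g∈′ with position S₀ i | position S₀ i′
  ... | inner j | inner j′ with ∈-inner⇒ j g∈ | ∈-inner⇒ j′ g∈′
  ...   | h , h∈ , refl | h′ , h′∈ , ιh′≡ιh =
            cong (innerIndex S₀) (A₀.disjoint j j′ h h∈ (subst (_∈ₛ lookup S₀ j′) (ι-inj ιh′≡ιh) h′∈))
  disjoint i i′ g g∈ g∈′ | inner j | last    = ⊥-elim (∈-last⇒∉H g∈′ (∈-inner⇒∈H j g∈))
  disjoint i i′ g g∈ g∈′ | last    | inner j = ⊥-elim (∈-last⇒∉H g∈ (∈-inner⇒∈H j g∈′))
  disjoint i i′ g g∈ g∈′ | last    | last    = refl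

  covering : ∀ g → ∃[ i ] g ∈ₛ lookup S i
  covering g with g ∈H?
  ... | yes (h , refl) = let (j , h∈) = A₀.covering h in innerIndex S₀ j , ∈-inner⇐ j h∈
  ... | no  g∉H        = lastIndex S₀ , ∉H⇒∈-last g∉H

  identity : ∃[ i ] (∀ g → (g ∈ₛ lookup S i) ⇔ (g ≡ ε))
  identity = let (j , ∈j⇔≡ε) = A₀.identity in innerIndex S₀ j , λ g → mk⇔
    (λ g∈ → let (h , h∈ , ιh≡g) = ∈-inner⇒ j g∈ in
            trans (sym ιh≡g) (trans (cong ι (Equivalence.to (∈j⇔≡ε h) h∈)) ι-ε))
    (λ { refl → subst (_∈ₛ lookup S (innerIndex S₀ j)) ι-ε
                        (∈-inner⇐ j (Equivalence.from (∈j⇔≡ε H.ε) refl)) })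

  inverses : ∀ i → ∃[ i′ ] (∀ g → (g ∈ₛ lookup S i′) ⇔ (∃[ x ] (x ∈ₛ lookup S i × g ≡ x ⁻¹)))
  inverses i with position S₀ i
  ... | inner j = let (j′ , ∈j′⇔) = A₀.inverses j in innerIndex S₀ j′ , λ g → mk⇔
    (λ g∈ → let (h , h∈ , ιh≡g) = ∈-inner⇒ j′ g∈
                (x , x∈ , h≡x⁻¹) = Equivalence.to (∈j′⇔ h) h∈
            in ι x , ∈-inner⇐ j x∈ , trans (sym ιh≡g) (trans (cong ι h≡x⁻¹) (ι-⁻¹ x)))
    (λ { (x , x∈ , refl) → let (y , y∈ , ιy≡x) = ∈-inner⇒ j x∈ in
           subst (_∈ₛ lookup S (innerIndex S₀ j′)) (trans (ι-⁻¹ y) (cong _⁻¹ ιy≡x))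
                 (∈-inner⇐ j′ (Equivalence.from (∈j′⇔ (y H.⁻¹)) (y , y∈ , refl))) })
  ... | last = lastIndex S₀ , λ g → mk⇔
    (λ g∈ → g ⁻¹ , ∉H⇒∈-last (∉H-⁻¹ (∈-last⇒∉H g∈)) , sym (G.⁻¹-involutive g))
    (λ { (x , x∈ , refl) → ∉H⇒∈-last (∉H-⁻¹ (∈-last⇒∉H x∈)) })

  module PG = Partition G S disjoint
  module PH = Partition H S₀ A₀.disjoint

  blockConstant-ι : ∀ {a} → PG.BlockConstant a → PH.BlockConstant (a ∘ ι)
  blockConstant-ι a-const j h∈ h′∈ = a-const (innerIndex S₀ j) (∈-inner⇐ j h∈) (∈-inner⇐ j h′∈)

  blockConstant-∉H : ∀ {a} → PG.BlockConstant a → ∀ {x y} → x ∉H → y ∉H → a x ≡ a y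
  blockConstant-∉H a-const x∉H y∉H =
    a-const (lastIndex S₀) (∉H⇒∈-last x∉H) (∉H⇒∈-last y∉H)

  blockConstant-intro : ∀ {a} → PH.BlockConstant (a ∘ ι) → (∀ {x y} → x ∉H → y ∉H → a x ≡ a y) →
                        PG.BlockConstant a
  blockConstant-intro ∘ι-const ∉H-const i {g} {g′} g∈ g′∈ with position S₀ i
  ... | inner j with ∈-inner⇒ j g∈ | ∈-inner⇒ j g′∈
  ...   | h , h∈ , refl | h′ , h′∈ , refl = ∘ι-const j h∈ h′∈
  blockConstant-intro ∘ι-const ∉H-const i {g} {g′} g∈ g′∈ | last =
    ∉H-const (∈-last⇒∉H g∈) (∈-last⇒∉H g′∈)

  oneZG-ι : ∀ h → oneZG G (ι h) ≡ oneZG H h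
  oneZG-ι h = cong (λ b → if b then ℤ.+ 1 else ℤ.+ 0)
    (does-⇔ (mk⇔ (λ ιh≡ε → ι-inj (trans ιh≡ε (sym ι-ε))) (λ h≡ε → trans (cong ι h≡ε) ι-ε))
            (ι h G.≟ ε) (h H.≟ H.ε))

  oneZG-∉H : ∀ {g} → g ∉H → oneZG G g ≡ 0ℤ
  oneZG-∉H {g} g∉H =
    cong (λ b → if b then ℤ.+ 1 else ℤ.+ 0) (dec-false (g G.≟ ε) λ { refl → g∉H ∈H-ε })

  unitInSpan : InSpan G S (oneZG G)
  unitInSpan = PG.blockConstant⇒inSpan nonempty covering (blockConstant-intro
    (λ j h∈ h′∈ → trans (oneZG-ι _)
                    (trans (PH.inSpan⇒blockConstant A₀.unitInSpan j h∈ h′∈) (sym (oneZG-ι _))))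
    (λ x∉H y∉H → trans (oneZG-∉H x∉H) (sym (oneZG-∉H y∉H))))

  module Multiplication {a b : ℤ[ G ]} (a-const : PG.BlockConstant a) (b-const : PG.BlockConstant b) where

    open import Data.Integer using (_*_)

    α β : ℤ
    α = a g₀
    β = b g₀

    a-∉H : ∀ {x} → x ∉H → a x ≡ α
    a-∉H x∉H = blockConstant-∉H a-const x∉H g₀∉H

    b-∉H : ∀ {x} → x ∉H → b x ≡ β
    b-∉H x∉H = blockConstant-∉H b-const x∉H g₀∉H

    ι-\\ : ∀ h h₀ → ι h ⁻¹ ∙ ι h₀ ≡ ι (h H.⁻¹ H.∙ h₀)
    ι-\\ h h₀ = sym (trans (ι-hom (h H.⁻¹) h₀) (cong (_∙ ι h₀) (ι-⁻¹ h)))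

    mul-ι : ∀ h₀ → mulZG G a b (ι h₀) ≡ mulZG H (a ∘ ι) (b ∘ ι) h₀ + ∑G (outside (λ _ → α * β))
    mul-ι h₀ = begin
      mulZG G a b (ι h₀)
        ≡⟨ ∑-split (λ x → a x * b (x ⁻¹ ∙ ι h₀)) ⟩
      ∑H (λ h → a (ι h) * b (ι h ⁻¹ ∙ ι h₀)) + ∑G (outside (λ x → a x * b (x ⁻¹ ∙ ι h₀)))
        ≡⟨ cong₂ _+_ (∑-cong H.enum λ h → cong (λ y → a (ι h) * b y) (ι-\\ h h₀))
                     (∑-outside-cong λ x x∉H →
                        cong₂ _*_ (a-∉H x∉H) (b-∉H (∉H-∙ʳ (∉H-⁻¹ x∉H) (h₀ , refl)))) ⟩
      mulZG H (a ∘ ι) (b ∘ ι) h₀ + ∑G (outside (λ _ → α * β))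
        ∎
      where open ≡-Reasoning

    mul-∉H : ∀ {g} → g ∉H →
             mulZG G a b g ≡ ∑H (λ h → a (ι h) * β) + (- ∑H (λ _ → α * β) + ∑G (λ x → α * b x))
    mul-∉H {g} g∉H = begin
      mulZG G a b g
        ≡⟨ ∑-split (λ x → a x * b (x ⁻¹ ∙ g)) ⟩
      ∑H (λ h → a (ι h) * b (ι h ⁻¹ ∙ g)) + ∑G (outside (λ x → a x * b (x ⁻¹ ∙ g)))
        ≡⟨ cong₂ _+_ (∑-cong H.enum λ h → cong (a (ι h) *_) (b-∉H (∉H-∙ˡ (∈H-⁻¹ (h , refl)) g∉H)))
                     (∑-outside-cong λ x x∉H → cong (_* b (x ⁻¹ ∙ g)) (a-∉H x∉H)) ⟩
      ∑H (λ h → a (ι h) * β) + ∑G (outside U)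
        ≡⟨ cong (∑H (λ h → a (ι h) * β) +_)
                (ℤ+.y≈x\\z (∑H (U ∘ ι)) (∑G (outside U)) (∑G U) (sym (∑-split U))) ⟩
      ∑H (λ h → a (ι h) * β) + (- ∑H (U ∘ ι) + ∑G U)
        ≡⟨ cong (λ s → ∑H (λ h → a (ι h) * β) + (- s + ∑G U))
                (∑-cong H.enum λ h → cong (α *_) (b-∉H (∉H-∙ˡ (∈H-⁻¹ (h , refl)) g∉H))) ⟩
      ∑H (λ h → a (ι h) * β) + (- ∑H (λ _ → α * β) + ∑G U)
        ≡⟨ cong (λ s → ∑H (λ h → a (ι h) * β) + (- ∑H (λ _ → α * β) + s))
                (∑-reindex G.enum (G.\\-↔ g) (λ y → α * b y)) ⟩
      ∑H (λ h → a (ι h) * β) + (- ∑H (λ _ → α * β) + ∑G (λ x → α * b x))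
        ∎
      where
      open ≡-Reasoning
      -- The sum of U over G ∖ H is its sum over G minus its sum over H; the first is independent of g
      -- by the substitution x ↦ x⁻¹ g, the second because b is β off H.
      U : Carrier G → ℤ
      U x = α * b (x ⁻¹ ∙ g)

    productInSpan : InSpan H S₀ (mulZG H (a ∘ ι) (b ∘ ι))
    productInSpan = A₀.mulClosed (a ∘ ι) (b ∘ ι)
      (PH.blockConstant⇒inSpan A₀.nonempty A₀.covering (blockConstant-ι a-const))
      (PH.blockConstant⇒inSpan A₀.nonempty A₀.covering (blockConstant-ι b-const))

    mul-blockConstant : PG.BlockConstant (mulZG G a b)
    mul-blockConstant = blockConstant-intro
      (λ j h∈ h′∈ → trans (mul-ι _)
                      (trans (cong (_+ _) (PH.inSpan⇒blockConstant productInSpan j h∈ h′∈)) (sym (mul-ι _))))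
      (λ x∉H y∉H → trans (mul-∉H x∉H) (sym (mul-∉H y∉H)))

  mulClosed : ∀ a b → InSpan G S a → InSpan G S b → InSpan G S (mulZG G a b)
  mulClosed a b a∈ b∈ = PG.blockConstant⇒inSpan nonempty covering
    (Multiplication.mul-blockConstant (PG.inSpan⇒blockConstant a∈) (PG.inSpan⇒blockConstant b∈))

  isSRing : IsSRing G S
  isSRing = record
    { nonempty = nonempty ; disjoint = disjoint ; covering = covering
    ; identity = identity ; inverses = inverses
    ; unitInSpan = unitInSpan ; mulClosed = mulClosed }

-- The isomorphism with the wreath product

module WreathIsomorphism (G H : FinGroup) (ι : Carrier H → Carrier G)
  (ι-hom : IsHom H G ι) (ι-inj : Injective _≡_ _≡_ ι)
  (m : ℕ) (m*|H|≡|G| : m ℕ.* order H ≡ order G)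
  (S₀ : List (Subset H)) (C : FinGroup) (|C|≡m : order C ≡ m) where

  open Subgroup G H ι ι-hom ι-inj
  open ImageProperties H G ι
  open G using (_∙_; _⁻¹; ε)
  module C = FinGroupProperties C
  module HC = FinGroupProperties (H ×ᴳ C)

  index≡|C| : index ≡ order C
  index≡|C| = trans (ℕ.*-cancelˡ-≡ index m (order H) {{nonZeroIndex (Inverse.to H.enum H.ε)}}
                      (trans (sym lagrange) (trans (sym m*|H|≡|G|) (ℕ.*-comm m (order H)))))
                    (sym |C|≡m)

  ψ : Transversal ↔ Carrier C
  ψ = ↔-trans (subst (λ n → Transversal ↔ Fin n) index≡|C| transversalEnum) (↔-sym C.enum)

  ψ-injective : ∀ {r r′} → Inverse.to ψ r ≡ Inverse.to ψ r′ → r ≡ r′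
  ψ-injective {r} {r′} eq =
    trans (sym (Inverse.strictlyInverseʳ ψ r)) (trans (cong (Inverse.from ψ) eq) (Inverse.strictlyInverseʳ ψ r′))

  opaque
    f : Carrier G ↔ (Carrier H × Carrier C)
    f = ↔-trans cosetDecomposition (↔-refl ×-↔ ψ)

    φ-components : ∀ g → Inverse.to f g ≡ (cosetPart g , Inverse.to ψ (representative g))
    φ-components g = refl

  φ : Carrier G → Carrier H × Carrier C
  φ = Inverse.to f

  φ⁻¹ : Carrier H × Carrier C → Carrier G
  φ⁻¹ = Inverse.from f

  φ-ι∙ : ∀ h g → φ (ι h ∙ g) ≡ (h , C.ε) HC.∙ φ g
  φ-ι∙ h g = begin
    φ (ι h ∙ g)
      ≡⟨ φ-components (ι h ∙ g) ⟩
    cosetPart (ι h ∙ g) , Inverse.to ψ (representative (ι h ∙ g))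
      ≡⟨ cong₂ _,_ (cosetPart-ι∙ h g) (cong (Inverse.to ψ) (representative-cong (ι∙-∼ h g))) ⟩
    h H.∙ cosetPart g , Inverse.to ψ (representative g)
      ≡⟨ cong (h H.∙ cosetPart g ,_) (C.identityˡ _) ⟨
    (h , C.ε) HC.∙ (cosetPart g , Inverse.to ψ (representative g))
      ≡⟨ cong ((h , C.ε) HC.∙_) (φ-components g) ⟨
    (h , C.ε) HC.∙ φ g
      ∎
    where open ≡-Reasoning

  φ₂≡⇔∼ : ∀ x y → proj₂ (φ x) ≡ proj₂ (φ y) ⇔ x ∼ y
  φ₂≡⇔∼ x y = mk⇔
    (λ eq → representative-≡⇒∼ (ψ-injective (trans (sym (φ₂ x)) (trans eq (φ₂ y)))))
    (λ x∼y → trans (φ₂ x) (trans (cong (Inverse.to ψ) (representative-cong x∼y)) (sym (φ₂ y))))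
    where
    φ₂ : ∀ g → proj₂ (φ g) ≡ Inverse.to ψ (representative g)
    φ₂ g = cong proj₂ (φ-components g)

  wreathInner : Subset H → Subset (H ×ᴳ C)
  wreathInner X hc = X (proj₁ hc) ∧ (proj₂ hc C.== C.ε)

  wreathOuter : Subset (H ×ᴳ C)
  wreathOuter hc = not (proj₂ hc C.== C.ε)

  E-image : ∀ X → Eimage G (H ×ᴳ C) φ (image H G ι X) ≐₂ Erel (H ×ᴳ C) (wreathInner X)
  E-image X a b = mk⇔ to from
    where
    to : Eimage G (H ×ᴳ C) φ (image H G ι X) a b → Erel (H ×ᴳ C) (wreathInner X) a b
    to (_ , _ , (g , x , x∈ , refl , refl) , refl , refl) with image-sound X x∈
    ... | h , h∈X , refl = φ g , (h , C.ε) , cong₂ _∧_ h∈X (C.≡⇒== refl) , refl , φ-ι∙ h g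
    from : Erel (H ×ᴳ C) (wreathInner X) a b → Eimage G (H ×ᴳ C) φ (image H G ι X) a b
    from (p , (h , c) , hc∈ , refl , refl) =
      φ⁻¹ p , ι h ∙ φ⁻¹ p , (φ⁻¹ p , ι h , image-complete X (∧-conicalˡ _ _ hc∈) , refl , refl) ,
      sym (Inverse.strictlyInverseˡ f p) ,
      sym (begin
        φ (ι h ∙ φ⁻¹ p)          ≡⟨ φ-ι∙ h (φ⁻¹ p) ⟩
        (h , C.ε) HC.∙ φ (φ⁻¹ p) ≡⟨ cong₂ HC._∙_ (cong (h ,_) (sym (C.==⇒≡ (∧-conicalʳ _ _ hc∈))))
                                               (Inverse.strictlyInverseˡ f p) ⟩
        (h , c) HC.∙ p           ∎)
      where open ≡-Reasoning

  wreathOuter⇔≢ε : ∀ hc → wreathOuter hc ≡ true ⇔ (proj₂ hc ≢ C.ε)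
  wreathOuter⇔≢ε (h , c) = mk⇔ (λ c∈ c≡ε → not-¬ (sym (C.≡⇒== c≡ε)) (sym c∈))
                               (λ c≢ε → sym (¬-not (c≢ε ∘ C.==⇒≡ ∘ sym)))

  E-complement : Eimage G (H ×ᴳ C) φ (complementImage H G ι) ≐₂ Erel (H ×ᴳ C) wreathOuter
  E-complement a b = mk⇔ to from
    where
    to : Eimage G (H ×ᴳ C) φ (complementImage H G ι) a b → Erel (H ×ᴳ C) wreathOuter a b
    to (_ , _ , (g , x , x∈ , refl , refl) , refl , refl) =
      φ g , quotient , Equivalence.from (wreathOuter⇔≢ε quotient) quotient≢ε , refl ,
      sym (HC.//-rightDividesˡ (φ g) (φ (x ∙ g)))
      where
      quotient : Carrier H × Carrier C
      quotient = φ (x ∙ g) HC.// φ g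
      quotient≢ε : proj₂ quotient ≢ C.ε
      quotient≢ε quotient≡ε = Equivalence.to (complementImage⇔∉H x) x∈
        (∙-∼⇒∈H (Equivalence.to (φ₂≡⇔∼ (x ∙ g) g) (C.x∙y⁻¹≈ε⇒x≈y _ _ quotient≡ε)))
    from : Erel (H ×ᴳ C) wreathOuter a b → Eimage G (H ×ᴳ C) φ (complementImage H G ι) a b
    from (p , z , z∈ , refl , refl) =
      φ⁻¹ p , φ⁻¹ q ,
      (φ⁻¹ p , φ⁻¹ q G.// φ⁻¹ p , Equivalence.from (complementImage⇔∉H _) quotient∉H , refl ,
       sym (G.//-rightDividesˡ (φ⁻¹ p) (φ⁻¹ q))) ,
      sym (Inverse.strictlyInverseˡ f p) , sym (Inverse.strictlyInverseˡ f q)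
      where
      q : Carrier H × Carrier C
      q = z HC.∙ p
      quotient∉H : φ⁻¹ q G.// φ⁻¹ p ∉H
      quotient∉H q∼p = Equivalence.to (wreathOuter⇔≢ε z) z∈ (C.identityˡ-unique (proj₂ z) (proj₂ p) (begin
        proj₂ z C.∙ proj₂ p        ≡⟨ cong proj₂ (Inverse.strictlyInverseˡ f q) ⟨
        proj₂ (φ (φ⁻¹ q))          ≡⟨ Equivalence.from (φ₂≡⇔∼ (φ⁻¹ q) (φ⁻¹ p)) q∼p ⟩
        proj₂ (φ (φ⁻¹ p))          ≡⟨ cong proj₂ (Inverse.strictlyInverseˡ f p) ⟩
        proj₂ p                    ∎))
        where open ≡-Reasoning

  private
    module S = MapSnoc (image H G ι) (complementImage H G ι)
    module W = MapSnoc wreathInner wreathOuter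

  isIdentitySet-identity : isIdentitySet C (C._== C.ε) ≡ true
  isIdentitySet-identity with isIdentitySet C (C._== C.ε) in all-agree
  ... | true  = refl
  ... | false with allFin-false (order C) _ all-agree
  ...   | i , disagrees-at-i with C.elem i C.== C.ε
  ...     | true  = case disagrees-at-i of λ ()
  ...     | false = case disagrees-at-i of λ ()

  isIdentitySet-nonidentity : isIdentitySet C (not ∘ (C._== C.ε)) ≡ false
  isIdentitySet-nonidentity with isIdentitySet C (not ∘ (C._== C.ε)) in all-agree
  ... | false = refl
  ... | true with allFin-sound (order C) _ all-agree (Inverse.to C.enum C.ε) | C.≡⇒== (C.elem-to C.ε)
  ...   | agrees-at-ε | ε==ε rewrite ε==ε with agrees-at-ε
  ...     | ()

  wreathPartition≡wreathList : wreathPartition H C S₀ (trivialPartition C) ≡ W.mapSnoc S₀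
  wreathPartition≡wreathList = filter-trivial isIdentitySet-identity isIdentitySet-nonidentity
    where
    filter-trivial : isIdentitySet C (C._== C.ε) ≡ true → isIdentitySet C (not ∘ (C._== C.ε)) ≡ false →
                     wreathPartition H C S₀ (trivialPartition C) ≡ W.mapSnoc S₀
    filter-trivial identity nonidentity with isIdentitySet C (C._== C.ε)
    filter-trivial refl nonidentity | true with isIdentitySet C (not ∘ (C._== C.ε))
    filter-trivial refl refl        | true | false = refl

  Corresponds : Fin (length (S.mapSnoc S₀)) → Fin (length (W.mapSnoc S₀)) → Set
  Corresponds i j = Eimage G (H ×ᴳ C) φ (lookup (S.mapSnoc S₀) i) ≐₂ Erel (H ×ᴳ C) (lookup (W.mapSnoc S₀) j)

  inner-corresponds : ∀ j → Corresponds (S.innerIndex S₀ j) (W.innerIndex S₀ j)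
  inner-corresponds j = subst₂ (λ X Y → Eimage G (H ×ᴳ C) φ X ≐₂ Erel (H ×ᴳ C) Y)
    (sym (S.lookup-innerIndex S₀ j)) (sym (W.lookup-innerIndex S₀ j)) (E-image (lookup S₀ j))

  last-corresponds : Corresponds (S.lastIndex S₀) (W.lastIndex S₀)
  last-corresponds = subst₂ (λ X Y → Eimage G (H ×ᴳ C) φ X ≐₂ Erel (H ×ᴳ C) Y)
    (sym (S.lookup-lastIndex S₀)) (sym (W.lookup-lastIndex S₀)) E-complement

  isoSRing-wreathList : IsoSRing G (S.mapSnoc S₀) (H ×ᴳ C) (W.mapSnoc S₀)
  isoSRing-wreathList = f , forward , backward
    where
    forward : ∀ i → ∃[ j ] Corresponds i j
    forward i with S.position S₀ i
    ... | S.inner j = W.innerIndex S₀ j , inner-corresponds j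
    ... | S.last    = W.lastIndex S₀ , last-corresponds
    backward : ∀ j → ∃[ i ] Corresponds i j
    backward j with W.position S₀ j
    ... | W.inner j′ = S.innerIndex S₀ j′ , inner-corresponds j′
    ... | W.last     = S.lastIndex S₀ , last-corresponds

  isoSRing : IsoSRing G (extendPartition H G ι S₀) (H ×ᴳ C) (wreathPartition H C S₀ (trivialPartition C))
  isoSRing =
    subst (IsoSRing G (extendPartition H G ι S₀) (H ×ᴳ C)) (sym wreathPartition≡wreathList) isoSRing-wreathList

open import Data.Nat using (_*_)

lemma2p5 : (G H : FinGroup) (ι : Carrier H → Carrier G)
    → IsHom H G ι → Injective _≡_ _≡_ ι
    → (∃[ g ] (∀ h → ι h ≢ g))
    → (m : ℕ) → m * order H ≡ order G
    → (S₀ : List (Subset H)) → IsSRing H S₀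
    → IsSRing G (extendPartition H G ι S₀)
      × ((C : FinGroup) → IsCyclic C → order C ≡ m
         → IsoSRing G (extendPartition H G ι S₀) (H ×ᴳ C) (wreathPartition H C S₀ (trivialPartition C)))
lemma2p5 G H ι ι-hom ι-inj (g₀ , ι≢g₀) m m*|H|≡|G| S₀ A₀ =
  Extension.isSRing G H ι ι-hom ι-inj g₀ ι≢g₀ S₀ A₀ ,
  λ C _ |C|≡m → WreathIsomorphism.isoSRing G H ι ι-hom ι-inj m m*|H|≡|G| S₀ C |C|≡m
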